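{- Let $G\le\mathrm{Sym}(n)$ be transitive, let $i,j\in[n]$ be distinct, and let $D_{i\to j}$ be the set of derangements in $G$ mapping $i$ to $j$. Let $D=D_{i\to j}\cup D_{j\to i}$. Then in $\mathrm{Cay}(G,\mathrm{Der}(G)\setminus D)$ the set $G_{j\to j}\cup G_{i\to j}$ is an independent set of size $2|G|/n$, where $G_{k\to l}=\{\sigma\in G:\sigma(k)=l\}$.
   Context: A derangement is a permutation with no fixed point; $\mathrm{Der}(G)$ is the set of derangements in $G$. For inverse-closed $S\subseteq G$ not containing the identity, $\mathrm{Cay}(G,S)$ is the graph on $G$ with $g,h$ adjacent iff $g^{ -1}h\in S$. -}

module Defs where

open import Data.Nat using (ℕ; _*_)
open import Data.Fin using (Fin; _≟_)
open import Data.Fin.Permutation using (Permutation′; _⟨$⟩ʳ_; _≈_; id; flip; _∘ₚ_)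
open import Data.List using (List; length; filter)
open import Data.List.Relation.Unary.Any using (Any)
open import Data.List.Relation.Unary.AllPairs using (AllPairs)
open import Data.Product using (Σ; _×_; ∃)
open import Data.Sum using (_⊎_)
open import Relation.Nullary using (¬_)
open import Relation.Nullary.Decidable using (_⊎-dec_)
open import Relation.Binary.PropositionalEquality using (_≡_)

_∈G_ : ∀ {n} → Permutation′ n → List (Permutation′ n) → Set
σ ∈G G = Any (λ τ → τ ≈ σ) G

record IsSubgroup {n : ℕ} (G : List (Permutation′ n)) : Set where
  field
    distinct : AllPairs (λ σ τ → ¬ (σ ≈ τ)) G
    has-id   : id ∈G G
    closed-∘ : ∀ {σ τ} → σ ∈G G → τ ∈G G → (σ ∘ₚ τ) ∈G G
    closed-⁻¹ : ∀ {σ} → σ ∈G G → flip σ ∈G G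

Transitive : ∀ {n} → List (Permutation′ n) → Set
Transitive {n} G = ∀ (x y : Fin n) → Σ (Permutation′ n) λ σ → σ ∈G G × (σ ⟨$⟩ʳ x ≡ y)

IsDerangement : ∀ {n} → Permutation′ n → Set
IsDerangement {n} σ = ∀ (x : Fin n) → ¬ (σ ⟨$⟩ʳ x ≡ x)

-- g⁻¹h as a permutation (x ↦ g⁻¹(h x)); note _∘ₚ_ is diagrammatic:
-- (π₁ ∘ₚ π₂) applies π₁ first.
_⁻¹·_ : ∀ {n} → Permutation′ n → Permutation′ n → Permutation′ n
g ⁻¹· h = h ∘ₚ flip g

-- Connection set S = Der(G) \ D where D = D_{i→j} ∪ D_{j→i}
-- (membership in G is automatic for g⁻¹h with g, h ∈ G).
InS : ∀ {n} → Fin n → Fin n → Permutation′ n → Set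
InS i j σ = IsDerangement σ × ¬ ((σ ⟨$⟩ʳ i ≡ j) ⊎ (σ ⟨$⟩ʳ j ≡ i))

Adj : ∀ {n} → Fin n → Fin n → Permutation′ n → Permutation′ n → Set
Adj i j g h = InS i j (g ⁻¹· h)

InI : ∀ {n} → Fin n → Fin n → Permutation′ n → Set
InI i j σ = (σ ⟨$⟩ʳ j ≡ j) ⊎ (σ ⟨$⟩ʳ i ≡ j)

Iset : ∀ {n} → Fin n → Fin n → List (Permutation′ n) → List (Permutation′ n)
Iset i j G = filter (λ σ → (σ ⟨$⟩ʳ j ≟ j) ⊎-dec (σ ⟨$⟩ʳ i ≟ j)) G

-- Two elements g, h of G_{j→j} ∪ G_{i→j} satisfy g⁻¹h(x) = y whenever h x = g y = j; so g⁻¹h fixes j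
-- or i (not a derangement), or sends i to j or j to i (it lies in D), and is never in the connection set.
-- For the size, right multiplication by some τ with τ l = l′ (transitivity) injects G_{k→l} into
-- G_{k→l′}, so the n sets G_{k→l} (l ∈ [n]) partitioning G all have |G|/n elements; G_{j→j} and
-- G_{i→j} are disjoint because i ≠ j.
module Submission where

open import Defs
open import Data.Bool.Base using (Bool; true; false)
open import Data.Empty using (⊥-elim)
open import Data.Fin using (Fin; _≟_) renaming (zero to fzero; suc to fsuc)
open import Data.Fin.Permutation using (Permutation′; _⟨$⟩ʳ_; _⟨$⟩ˡ_; inverseˡ; _∘ₚ_)
open import Data.List using (List; []; _∷_; length; filter; map)
open import Data.List.Properties using (length-removeAt′; length-map)
open import Data.List.Relation.Unary.Any using (here; there)
import Data.List.Relation.Unary.Any as Any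
import Data.List.Membership.Setoid as Membership
import Data.List.Membership.Setoid.Properties as Membershipₚ
import Data.List.Relation.Binary.Subset.Setoid as Subset
import Data.List.Relation.Unary.Unique.Setoid as Unique
import Data.List.Relation.Unary.Unique.Setoid.Properties as Uniqueₚ
open import Data.List.Relation.Unary.AllPairs using (_∷_)
open import Data.Nat using (ℕ; zero; suc; _+_; _*_; _≤_; z≤n; s≤s)
open import Data.Nat.Properties
  using (+-0-commutativeMonoid; +-suc; +-identityʳ; *-comm; *-distribʳ-+; ≤-antisym; module ≤-Reasoning)
open import Data.Product using (_×_; _,_)
open import Data.Sum using (inj₁; inj₂)
open import Level using (0ℓ)
open import Relation.Binary.Bundles using (Setoid)
open import Relation.Binary.Definitions using (_Respects_)
import Relation.Binary.Construct.On as On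
open import Relation.Binary.PropositionalEquality
  using (_≡_; refl; sym; trans; cong; cong₂; _→-setoid_; module ≡-Reasoning)
open import Relation.Nullary using (¬_; does; yes; no)
open import Relation.Nullary.Decidable using (_⊎-dec_)
open import Relation.Unary using (Pred; Decidable)

open import Algebra.Properties.CommutativeMonoid.Sum +-0-commutativeMonoid
  using (sum-syntax; ∑-distrib-+; sum-cong-≗; sum-replicate-zero)

indicator : Bool → ℕ
indicator true  = 1
indicator false = 0

∑-const : ∀ n c → ∑[ _ < n ] c ≡ n * c
∑-const zero    c = refl
∑-const (suc n) c = cong (c +_) (∑-const n c)

∑-indicator : ∀ {n} (a : Fin n) → ∑[ l < n ] indicator (does (a ≟ l)) ≡ 1
∑-indicator {suc n} fzero    = cong suc (sum-replicate-zero n)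
∑-indicator         (fsuc a) = ∑-indicator a

module _ {a p} {A : Set a} {P : Pred A p} (P? : Decidable P) where

  length-filter-∷ : ∀ x xs →
                    length (filter P? (x ∷ xs)) ≡ indicator (does (P? x)) + length (filter P? xs)
  length-filter-∷ x xs with does (P? x)
  ... | true  = refl
  ... | false = refl

  module _ {q} {Q : Pred A q} (Q? : Decidable Q) (disjoint : ∀ x → P x → ¬ Q x) where

    length-filter-⊎ : ∀ xs → length (filter (λ x → P? x ⊎-dec Q? x) xs)
                             ≡ length (filter P? xs) + length (filter Q? xs)
    length-filter-⊎ []       = refl
    length-filter-⊎ (x ∷ xs) with P? x | Q? x
    ... | yes Px | yes Qx = ⊥-elim (disjoint x Px Qx)
    ... | yes _  | no _   = cong suc (length-filter-⊎ xs)
    ... | no _   | yes _  = trans (cong suc (length-filter-⊎ xs)) (sym (+-suc _ _))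
    ... | no _   | no _   = length-filter-⊎ xs

module _ {a} {A : Set a} {n} (f : A → Fin n) where

  fibre : Fin n → List A → List A
  fibre l = filter (λ x → f x ≟ l)

  ∑-length-fibre : ∀ xs → ∑[ l < n ] length (fibre l xs) ≡ length xs
  ∑-length-fibre []       = sum-replicate-zero n
  ∑-length-fibre (x ∷ xs) = begin
    ∑[ l < n ] length (fibre l (x ∷ xs))
      ≡⟨ sum-cong-≗ (λ l → length-filter-∷ (λ y → f y ≟ l) x xs) ⟩
    ∑[ l < n ] (indicator (does (f x ≟ l)) + length (fibre l xs))
      ≡⟨ ∑-distrib-+ (λ l → indicator (does (f x ≟ l))) (λ l → length (fibre l xs)) ⟩
    ∑[ l < n ] indicator (does (f x ≟ l)) + ∑[ l < n ] length (fibre l xs)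
      ≡⟨ cong₂ _+_ (∑-indicator (f x)) (∑-length-fibre xs) ⟩
    suc (length xs) ∎
    where open ≡-Reasoning

  length≡*-of-equal-fibres : ∀ xs c → (∀ l → length (fibre l xs) ≡ c) → length xs ≡ n * c
  length≡*-of-equal-fibres xs c fibres≡c =
    trans (sym (∑-length-fibre xs)) (trans (sum-cong-≗ fibres≡c) (∑-const n c))

module _ {a ℓ} (S : Setoid a ℓ) where
  open Setoid S renaming (refl to ≈-refl; sym to ≈-sym; trans to ≈-trans)
  open Membership S using (_∈_; _─_)
  open Unique S using (Unique)
  open Subset S using (_⊆_)

  ∈-─⁺ : ∀ {x y xs} (x∈xs : x ∈ xs) → y ∈ xs → ¬ x ≈ y → y ∈ xs ─ x∈xs
  ∈-─⁺ (here x≈z)  (here y≈z)  x≉y = ⊥-elim (x≉y (≈-trans x≈z (≈-sym y≈z)))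
  ∈-─⁺ (here _)    (there y∈)  _   = y∈
  ∈-─⁺ (there _)   (here y≈z)  _   = here y≈z
  ∈-─⁺ (there x∈)  (there y∈)  x≉y = there (∈-─⁺ x∈ y∈ x≉y)

  Unique-⊆⇒length-≤ : ∀ {xs ys} → Unique xs → xs ⊆ ys → length xs ≤ length ys
  Unique-⊆⇒length-≤ {[]}     _ _ = z≤n
  Unique-⊆⇒length-≤ {x ∷ xs} {ys} xs!@(_ ∷ xs′!) xs⊆ys = begin
    suc (length xs)           ≤⟨ s≤s (Unique-⊆⇒length-≤ xs′! xs⊆ys─x) ⟩
    suc (length (ys ─ x∈ys))  ≡⟨ sym (length-removeAt′ ys _) ⟩
    length ys                 ∎
    where
    open ≤-Reasoning
    x∈ys = xs⊆ys (here ≈-refl)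
    xs⊆ys─x : xs ⊆ ys ─ x∈ys
    xs⊆ys─x y∈xs = ∈-─⁺ x∈ys (xs⊆ys (there y∈xs))
      (λ x≈y → Uniqueₚ.Unique[x∷xs]⇒x∉xs S xs! (Membershipₚ.∈-resp-≈ S (≈-sym x≈y) y∈xs))

≈-setoid : ℕ → Setoid 0ℓ 0ℓ
≈-setoid n = On.setoid (Fin n →-setoid Fin n) _⟨$⟩ʳ_

module _ {n : ℕ} where
  open Data.Fin.Permutation using (_≈_)
  open Membership (≈-setoid n) using (_∈_)

  ∈G⇒∈ : ∀ {σ G} → σ ∈G G → σ ∈ G
  ∈G⇒∈ = Any.map λ τ≈σ x → sym (τ≈σ x)

  ∈⇒∈G : ∀ {σ G} → σ ∈ G → σ ∈G G
  ∈⇒∈G = Any.map λ σ≈τ x → sym (σ≈τ x)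

  ⟨$⟩ʳ-injective : ∀ (π : Permutation′ n) {x y} → π ⟨$⟩ʳ x ≡ π ⟨$⟩ʳ y → x ≡ y
  ⟨$⟩ʳ-injective π πx≡πy = trans (sym (inverseˡ π)) (trans (cong (π ⟨$⟩ˡ_) πx≡πy) (inverseˡ π))

  ⟨$⟩ʳ-resp-≈ : ∀ (k l : Fin n) → (λ σ → σ ⟨$⟩ʳ k ≡ l) Respects Setoid._≈_ (≈-setoid n)
  ⟨$⟩ʳ-resp-≈ k l σ≈ρ σk≡l = trans (sym (σ≈ρ k)) σk≡l

  ∘ₚ-cancelʳ : ∀ {σ ρ : Permutation′ n} τ → σ ∘ₚ τ ≈ ρ ∘ₚ τ → σ ≈ ρ
  ∘ₚ-cancelʳ τ στ≈ρτ x = ⟨$⟩ʳ-injective τ (στ≈ρτ x)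

  ⁻¹·-⟨$⟩ʳ : ∀ (g h : Permutation′ n) {x y z} →
             h ⟨$⟩ʳ x ≡ z → g ⟨$⟩ʳ y ≡ z → (g ⁻¹· h) ⟨$⟩ʳ x ≡ y
  ⁻¹·-⟨$⟩ʳ g h hx≡z gy≡z = trans (cong (g ⟨$⟩ˡ_) (trans hx≡z (sym gy≡z))) (inverseˡ g)

  InI⇒¬Adj : ∀ {i j} (g h : Permutation′ n) → InI i j g → InI i j h → ¬ Adj i j g h
  InI⇒¬Adj g h (inj₁ gj≡j) (inj₁ hj≡j) (der , _) = der _ (⁻¹·-⟨$⟩ʳ g h hj≡j gj≡j)
  InI⇒¬Adj g h (inj₂ gi≡j) (inj₂ hi≡j) (der , _) = der _ (⁻¹·-⟨$⟩ʳ g h hi≡j gi≡j)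
  InI⇒¬Adj g h (inj₁ gj≡j) (inj₂ hi≡j) (_ , ∉D)  = ∉D (inj₁ (⁻¹·-⟨$⟩ʳ g h hi≡j gj≡j))
  InI⇒¬Adj g h (inj₂ gi≡j) (inj₁ hj≡j) (_ , ∉D)  = ∉D (inj₂ (⁻¹·-⟨$⟩ʳ g h hj≡j gi≡j))

  _[_↦_] : List (Permutation′ n) → Fin n → Fin n → List (Permutation′ n)
  G [ k ↦ l ] = fibre (_⟨$⟩ʳ k) l G

  module _ {G : List (Permutation′ n)} (G-subgroup : IsSubgroup G) where
    open IsSubgroup G-subgroup
    open Subset (≈-setoid n) using (_⊆_)
    open Unique (≈-setoid n) using (Unique)

    -- Implicit permutations are passed by hand throughout: ≈ unfolds to a pointwise
    -- statement about _⟨$⟩ʳ_, from which Agda cannot recover them.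
    length-[↦]-≤ : ∀ (k : Fin n) {l l′} {τ : Permutation′ n} → τ ∈G G → τ ⟨$⟩ʳ l ≡ l′ →
                   length (G [ k ↦ l ]) ≤ length (G [ k ↦ l′ ])
    length-[↦]-≤ k {l} {l′} {τ} τ∈G τl≡l′ = begin
      length (G [ k ↦ l ])                ≡⟨ sym (length-map (_∘ₚ τ) (G [ k ↦ l ])) ⟩
      length (map (_∘ₚ τ) (G [ k ↦ l ]))  ≤⟨ Unique-⊆⇒length-≤ (≈-setoid n) image-unique (λ {ρ} → image-⊆ {ρ}) ⟩
      length (G [ k ↦ l′ ])               ∎
      where
      open ≤-Reasoning
      image-unique : Unique (map (_∘ₚ τ) (G [ k ↦ l ]))
      image-unique = Uniqueₚ.map⁺ (≈-setoid n) (≈-setoid n) (λ {σ} {ρ} → ∘ₚ-cancelʳ {σ} {ρ} τ)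
                       (Uniqueₚ.filter⁺ (≈-setoid n) (λ σ → σ ⟨$⟩ʳ k ≟ l) distinct)
      image-⊆ : map (_∘ₚ τ) (G [ k ↦ l ]) ⊆ G [ k ↦ l′ ]
      image-⊆ {ρ} ρ∈ =
        let σ , σ∈ , ρ≈στ = Membershipₚ.∈-map⁻ (≈-setoid n) (≈-setoid n) {v = ρ} ρ∈
            σ∈G , σk≡l    = Membershipₚ.∈-filter⁻ (≈-setoid n) (λ σ → σ ⟨$⟩ʳ k ≟ l)
                              (λ {σ ρ} → ⟨$⟩ʳ-resp-≈ k l {σ} {ρ}) {v = σ} σ∈
            στ∈G          = ∈G⇒∈ {σ ∘ₚ τ} (closed-∘ {σ} {τ} (∈⇒∈G {σ} σ∈G) τ∈G)
        in Membershipₚ.∈-filter⁺ (≈-setoid n) (λ σ → σ ⟨$⟩ʳ k ≟ l′)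
             (λ {σ ρ} → ⟨$⟩ʳ-resp-≈ k l′ {σ} {ρ}) {v = ρ}
             (Membershipₚ.∈-resp-≈ (≈-setoid n) {x = σ ∘ₚ τ} {y = ρ} (λ x → sym (ρ≈στ x)) στ∈G)
             (trans (ρ≈στ k) (trans (cong (τ ⟨$⟩ʳ_) σk≡l) τl≡l′))

    module _ (transitive : Transitive G) where

      length-[↦]≡ : ∀ (k l l′ : Fin n) → length (G [ k ↦ l ]) ≡ length (G [ k ↦ l′ ])
      length-[↦]≡ k l l′ with transitive l l′ | transitive l′ l
      ... | τ , τ∈G , τl≡l′ | τ′ , τ′∈G , τ′l′≡l =
        ≤-antisym (length-[↦]-≤ k {τ = τ} τ∈G τl≡l′) (length-[↦]-≤ k {τ = τ′} τ′∈G τ′l′≡l)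

      length-[↦]*n≡length : ∀ (k l : Fin n) → length (G [ k ↦ l ]) * n ≡ length G
      length-[↦]*n≡length k l = trans (*-comm _ n)
        (sym (length≡*-of-equal-fibres (_⟨$⟩ʳ k) G _ λ l′ → length-[↦]≡ k l′ l))

proposition2p1 : (n : ℕ) (G : List (Permutation′ n)) → IsSubgroup G → Transitive G →
    (i j : Fin n) → ¬ (i ≡ j) →
    ((g h : Permutation′ n) → g ∈G G → h ∈G G → InI i j g → InI i j h → ¬ Adj i j g h)
    × (length (Iset i j G) * n ≡ 2 * length G)
proposition2p1 n G G-subgroup transitive i j i≢j = (λ g h _ _ → InI⇒¬Adj g h) , counting
  where
  open ≡-Reasoning
  length-[↦j]*n : ∀ k → length (G [ k ↦ j ]) * n ≡ length G
  length-[↦j]*n k = length-[↦]*n≡length G-subgroup transitive k j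
  fixes-j⇒¬sends-i↦j : ∀ (σ : Permutation′ n) → σ ⟨$⟩ʳ j ≡ j → ¬ σ ⟨$⟩ʳ i ≡ j
  fixes-j⇒¬sends-i↦j σ σj≡j σi≡j = i≢j (⟨$⟩ʳ-injective σ (trans σi≡j (sym σj≡j)))
  counting : length (Iset i j G) * n ≡ 2 * length G
  counting = begin
    length (Iset i j G) * n
      ≡⟨ cong (_* n) (length-filter-⊎ (λ σ → σ ⟨$⟩ʳ j ≟ j) (λ σ → σ ⟨$⟩ʳ i ≟ j) fixes-j⇒¬sends-i↦j G) ⟩
    (length (G [ j ↦ j ]) + length (G [ i ↦ j ])) * n
      ≡⟨ *-distribʳ-+ n (length (G [ j ↦ j ])) _ ⟩
    length (G [ j ↦ j ]) * n + length (G [ i ↦ j ]) * n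
      ≡⟨ cong₂ _+_ (length-[↦j]*n j) (length-[↦j]*n i) ⟩
    length G + length G
      ≡⟨ cong (length G +_) (sym (+-identityʳ _)) ⟩
    2 * length G ∎
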